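{- Let $R=\mathbb{Z}_{25}$. The set $\mathfrak{k}_{\mathbb{Z}_{25}}$ consisting of the following $21$ points of the projective Hjelmslev plane $\mathrm{PHG}(2,\mathbb{Z}_{25})$ is a $2$-arc (i.e. a $(21,2)$-arc: no three of its points are collinear): $(1:1:4)$, $(1:19:19)$, $(1:4:1)$, $(1:1:22)$, $(1:8:8)$, $(1:22:1)$, $(1:3:12)$, $(1:23:19)$, $(1:4:17)$, $(1:7:8)$, $(1:22:4)$, $(1:19:18)$, $(1:7:22)$, $(1:8:6)$, $(1:21:18)$, $(5:1:2)$, $(1:15:13)$, $(1:2:5)$, $(5:1:23)$, $(1:10:12)$, $(1:23:5)$. In particular, the maximum size $n_2(\mathbb{Z}_{25})$ of a $2$-arc in $\mathrm{PHG}(2,\mathbb{Z}_{25})$ satisfies $n_2(\mathbb{Z}_{25})\ge 21$.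
   Context: For a finite chain ring $R$ (a finite ring with identity whose left ideals form a chain), the projective Hjelmslev plane $\mathrm{PHG}(2,R)$ has as points the free right $R$-submodules of $R^3$ of rank $1$ and as lines the free right $R$-submodules of $R^3$ of rank $2$, with incidence given by inclusion. A point $(a:b:c)$ denotes the submodule $(a,b,c)^{T}R$, where at least one coordinate is a unit. Points are collinear if they are all contained in a common line. A set $\mathfrak{k}$ of $n$ points is a $(n,2)$-arc (a $2$-arc) if no three of its elements are collinear (some two, hence any two, points lie on a common line). $n_2(R)$ denotes the maximum size of a $2$-arc in $\mathrm{PHG}(2,R)$. -}

module Defs where

open import Data.Nat using (ℕ; _+_; _*_)
open import Data.Nat.DivMod using (_mod_)
open import Data.Fin using (Fin; toℕ; #_)
open import Data.Vec using (Vec; _∷_; []; lookup)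
open import Data.Product using (Σ; ∃; _×_; _,_)
open import Data.Sum using (_⊎_)
open import Relation.Binary.PropositionalEquality using (_≡_; _≢_)
open import Relation.Nullary using (¬_)

ℤ₂₅ : Set
ℤ₂₅ = Fin 25

infixl 6 _⊕_
infixl 7 _⊗_

_⊕_ : ℤ₂₅ → ℤ₂₅ → ℤ₂₅
a ⊕ b = (toℕ a + toℕ b) mod 25

_⊗_ : ℤ₂₅ → ℤ₂₅ → ℤ₂₅
a ⊗ b = (toℕ a * toℕ b) mod 25

𝟘 𝟙 : ℤ₂₅
𝟘 = # 0
𝟙 = # 1

IsUnit : ℤ₂₅ → Set
IsUnit a = ∃ λ b → a ⊗ b ≡ 𝟙

record V3 : Set where
  constructor ⟨_,_,_⟩
  field
    c₁ c₂ c₃ : ℤ₂₅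
open V3 public

zeroV : V3
zeroV = ⟨ 𝟘 , 𝟘 , 𝟘 ⟩

_+ᵛ_ : V3 → V3 → V3
⟨ a , b , c ⟩ +ᵛ ⟨ a' , b' , c' ⟩ = ⟨ a ⊕ a' , b ⊕ b' , c ⊕ c' ⟩

_·_ : V3 → ℤ₂₅ → V3
⟨ a , b , c ⟩ · r = ⟨ a ⊗ r , b ⊗ r , c ⊗ r ⟩

-- (a:b:c) denotes the submodule (a,b,c)ᵀR; it is a point (free of rank 1)
-- iff some coordinate is a unit.
IsPoint : V3 → Set
IsPoint ⟨ a , b , c ⟩ = IsUnit a ⊎ IsUnit b ⊎ IsUnit c

SamePoint : V3 → V3 → Set
SamePoint p q = (∃ λ r → p ≡ q · r) × (∃ λ r → q ≡ p · r)

-- uR + vR is free of rank 2 with basis (u , v): the map R² → R³, (r,s) ↦ ur + vs, is injective.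
-- Every line of PHG(2,R) is of the form uR + vR for such a pair.
IsFreeRank2 : V3 → V3 → Set
IsFreeRank2 u v = ∀ r s → (u · r) +ᵛ (v · s) ≡ zeroV → (r ≡ 𝟘) × (s ≡ 𝟘)

InSpan : V3 → V3 → V3 → Set
InSpan u v p = ∃ λ r → ∃ λ s → p ≡ (u · r) +ᵛ (v · s)

Collinear : V3 → V3 → V3 → Set
Collinear p q w = ∃ λ u → ∃ λ v → IsFreeRank2 u v × InSpan u v p × InSpan u v q × InSpan u v w

Is2Arc : {n : ℕ} → (Fin n → V3) → Set
Is2Arc {n} k =
  (∀ i → IsPoint (k i)) ×
  (∀ i j → i ≢ j → ¬ SamePoint (k i) (k j)) ×
  (∀ i j l → i ≢ j → i ≢ l → j ≢ l → ¬ Collinear (k i) (k j) (k l))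

pt : ℕ → ℕ → ℕ → V3
pt a b c = ⟨ a mod 25 , b mod 25 , c mod 25 ⟩

kZ25-list : Vec V3 21
kZ25-list =
  pt 1 1 4 ∷ pt 1 19 19 ∷ pt 1 4 1 ∷ pt 1 1 22 ∷ pt 1 8 8 ∷ pt 1 22 1 ∷
  pt 1 3 12 ∷ pt 1 23 19 ∷ pt 1 4 17 ∷ pt 1 7 8 ∷ pt 1 22 4 ∷ pt 1 19 18 ∷
  pt 1 7 22 ∷ pt 1 8 6 ∷ pt 1 21 18 ∷ pt 5 1 2 ∷ pt 1 15 13 ∷ pt 1 2 5 ∷
  pt 5 1 23 ∷ pt 1 10 12 ∷ pt 1 23 5 ∷ []

kZ25 : Fin 21 → V3
kZ25 i = lookup kZ25-list i

module Submission where

-- Each of the three defining properties of a 2-arc is reduced to a decidable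
-- sufficient condition, which is then verified by computation on the 21 points.
--
--  * Being a point: some coordinate is a unit; the units of ℤ₂₅ are found by
--    searching all 25 candidate inverses.
--  * Distinctness: pR = qR forces p = q·r for some scalar r, so it suffices
--    that no listed point is a scalar multiple of another one.
--  * Non-collinearity: points on a line uR + vR are combinations of u and v,
--    so their determinant vanishes.  As ℤ₂₅ is given without subtraction, the
--    determinant is split as Δ⁺ − Δ⁻ and its vanishing reads Δ⁺ = Δ⁻.  This is
--    proved by lifting to ℕ: reduction mod 25 is a homomorphism ℕ → ℤ₂₅ for
--    + and *, such maps commute with Δ⁺ and Δ⁻, and over ℕ the equation
--    Δ⁺ = Δ⁻ for three combinations of two vectors is a polynomial identity.

open import Defs
open import Level using (0ℓ)
open import Algebra.Bundles.Raw using (RawSemiring)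
open import Data.Nat using (ℕ; _+_; _*_; _%_; +-*-rawSemiring)
open import Data.Nat.DivMod using (_mod_; m%n<n; %-distribˡ-+; %-distribˡ-*)
open import Data.Nat.Tactic.RingSolver using (solve-∀)
open import Data.Fin using (toℕ; _≟_)
open import Data.Fin.Properties using (toℕ-fromℕ<; toℕ-injective; all?; any?)
open import Data.Product using (_×_; _,_)
open import Function using (_∘_)
open import Relation.Binary.Definitions using (DecidableEquality)
open import Relation.Nullary using (¬_; ¬?; _×-dec_; _⊎-dec_; _→-dec_; map′)
open import Relation.Nullary.Decidable using (from-yes)
open import Relation.Unary using (Decidable)
open import Relation.Binary.PropositionalEquality
  using (_≡_; _≢_; refl; sym; trans; cong; cong₂; module ≡-Reasoning)

cong₃ : {A B C D : Set} (f : A → B → C → D) {a a′ : A} {b b′ : B} {c c′ : C} →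
        a ≡ a′ → b ≡ b′ → c ≡ c′ → f a b c ≡ f a′ b′ c′
cong₃ f refl refl refl = refl

reduce : ℕ → ℤ₂₅
reduce a = a mod 25

toℕ-reduce : ∀ a → toℕ (reduce a) ≡ a % 25
toℕ-reduce a = toℕ-fromℕ< (m%n<n a 25)

reduce-cong : ∀ a b → a % 25 ≡ b % 25 → reduce a ≡ reduce b
reduce-cong a b a≡b = toℕ-injective (trans (toℕ-reduce a) (trans a≡b (sym (toℕ-reduce b))))

-- Reduction is additive: note that  reduce a ⊕ reduce b  unfolds to the
-- reduction of  toℕ (reduce a) + toℕ (reduce b).
reduce-+ : ∀ a b → reduce (a + b) ≡ reduce a ⊕ reduce b
reduce-+ a b = reduce-cong (a + b) (toℕ (reduce a) + toℕ (reduce b)) (begin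
  (a + b) % 25                           ≡⟨ %-distribˡ-+ a b 25 ⟩
  (a % 25 + b % 25) % 25                 ≡⟨ cong₂ (λ x y → (x + y) % 25) (sym (toℕ-reduce a)) (sym (toℕ-reduce b)) ⟩
  (toℕ (reduce a) + toℕ (reduce b)) % 25 ∎)
  where open ≡-Reasoning

reduce-* : ∀ a b → reduce (a * b) ≡ reduce a ⊗ reduce b
reduce-* a b = reduce-cong (a * b) (toℕ (reduce a) * toℕ (reduce b)) (begin
  (a * b) % 25                           ≡⟨ %-distribˡ-* a b 25 ⟩
  (a % 25 * (b % 25)) % 25               ≡⟨ cong₂ (λ x y → (x * y) % 25) (sym (toℕ-reduce a)) (sym (toℕ-reduce b)) ⟩
  (toℕ (reduce a) * toℕ (reduce b)) % 25 ∎)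
  where open ≡-Reasoning

Triple : Set → Set
Triple A = A × A × A

map³ : {A B : Set} → (A → B) → Triple A → Triple B
map³ f (a , b , c) = (f a , f b , f c)

-- The 3×3 determinant with rows x, y, z is  Δ⁺ x y z − Δ⁻ x y z : the sums of
-- the terms belonging to even and to odd permutations.  Keeping them apart
-- makes sense without subtraction.
module Determinant (R : RawSemiring 0ℓ 0ℓ) where
  open RawSemiring R renaming (_+_ to _+ᴿ_; _*_ to _*ᴿ_)

  Δ⁺ Δ⁻ : Triple Carrier → Triple Carrier → Triple Carrier → Carrier
  Δ⁺ (x₁ , x₂ , x₃) (y₁ , y₂ , y₃) (z₁ , z₂ , z₃) = x₁ *ᴿ y₂ *ᴿ z₃ +ᴿ x₂ *ᴿ y₃ *ᴿ z₁ +ᴿ x₃ *ᴿ y₁ *ᴿ z₂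
  Δ⁻ (x₁ , x₂ , x₃) (y₁ , y₂ , y₃) (z₁ , z₂ , z₃) = x₁ *ᴿ y₃ *ᴿ z₂ +ᴿ x₂ *ᴿ y₁ *ᴿ z₃ +ᴿ x₃ *ᴿ y₂ *ᴿ z₁

module DeterminantHomomorphism
  (R S : RawSemiring 0ℓ 0ℓ)
  (h : RawSemiring.Carrier R → RawSemiring.Carrier S)
  (h-+ : ∀ a b → h (RawSemiring._+_ R a b) ≡ RawSemiring._+_ S (h a) (h b))
  (h-* : ∀ a b → h (RawSemiring._*_ R a b) ≡ RawSemiring._*_ S (h a) (h b))
  where
  open RawSemiring R using () renaming (_+_ to _+ᴿ_; _*_ to _*ᴿ_)
  open RawSemiring S using () renaming (_+_ to _+ˢ_; _*_ to _*ˢ_)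
  open Determinant R using () renaming (Δ⁺ to Δ⁺ᴿ; Δ⁻ to Δ⁻ᴿ)
  open Determinant S using () renaming (Δ⁺ to Δ⁺ˢ; Δ⁻ to Δ⁻ˢ)

  h-sum₃ : ∀ a b c → h (a +ᴿ b +ᴿ c) ≡ h a +ˢ h b +ˢ h c
  h-sum₃ a b c = trans (h-+ (a +ᴿ b) c) (cong (_+ˢ h c) (h-+ a b))

  h-product₃ : ∀ a b c → h (a *ᴿ b *ᴿ c) ≡ h a *ˢ h b *ˢ h c
  h-product₃ a b c = trans (h-* (a *ᴿ b) c) (cong (_*ˢ h c) (h-* a b))

  h-cubic : ∀ a₁ b₁ c₁ a₂ b₂ c₂ a₃ b₃ c₃ →
    h (a₁ *ᴿ b₁ *ᴿ c₁ +ᴿ a₂ *ᴿ b₂ *ᴿ c₂ +ᴿ a₃ *ᴿ b₃ *ᴿ c₃)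
      ≡ h a₁ *ˢ h b₁ *ˢ h c₁ +ˢ h a₂ *ˢ h b₂ *ˢ h c₂ +ˢ h a₃ *ˢ h b₃ *ˢ h c₃
  h-cubic a₁ b₁ c₁ a₂ b₂ c₂ a₃ b₃ c₃ =
    trans (h-sum₃ _ _ _)
          (cong₂ _+ˢ_ (cong₂ _+ˢ_ (h-product₃ a₁ b₁ c₁) (h-product₃ a₂ b₂ c₂)) (h-product₃ a₃ b₃ c₃))

  Δ⁺-hom : ∀ x y z → h (Δ⁺ᴿ x y z) ≡ Δ⁺ˢ (map³ h x) (map³ h y) (map³ h z)
  Δ⁺-hom (x₁ , x₂ , x₃) (y₁ , y₂ , y₃) (z₁ , z₂ , z₃) = h-cubic x₁ y₂ z₃ x₂ y₃ z₁ x₃ y₁ z₂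

  Δ⁻-hom : ∀ x y z → h (Δ⁻ᴿ x y z) ≡ Δ⁻ˢ (map³ h x) (map³ h y) (map³ h z)
  Δ⁻-hom (x₁ , x₂ , x₃) (y₁ , y₂ , y₃) (z₁ , z₂ , z₃) = h-cubic x₁ y₃ z₂ x₂ y₁ z₃ x₃ y₂ z₁

open Determinant +-*-rawSemiring using () renaming (Δ⁺ to Δ⁺ℕ; Δ⁻ to Δ⁻ℕ)

combine : Triple ℕ → Triple ℕ → ℕ → ℕ → Triple ℕ
combine (u₁ , u₂ , u₃) (v₁ , v₂ , v₃) r s = (u₁ * r + v₁ * s , u₂ * r + v₂ * s , u₃ * r + v₃ * s)

Δ-span-vanishes : ∀ u v r₁ s₁ r₂ s₂ r₃ s₃ →
  Δ⁺ℕ (combine u v r₁ s₁) (combine u v r₂ s₂) (combine u v r₃ s₃)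
    ≡ Δ⁻ℕ (combine u v r₁ s₁) (combine u v r₂ s₂) (combine u v r₃ s₃)
Δ-span-vanishes (u₁ , u₂ , u₃) (v₁ , v₂ , v₃) = identity u₁ u₂ u₃ v₁ v₂ v₃
  where
  identity : ∀ u₁ u₂ u₃ v₁ v₂ v₃ r₁ s₁ r₂ s₂ r₃ s₃ →
      (u₁ * r₁ + v₁ * s₁) * (u₂ * r₂ + v₂ * s₂) * (u₃ * r₃ + v₃ * s₃)
    + (u₂ * r₁ + v₂ * s₁) * (u₃ * r₂ + v₃ * s₂) * (u₁ * r₃ + v₁ * s₃)
    + (u₃ * r₁ + v₃ * s₁) * (u₁ * r₂ + v₁ * s₂) * (u₂ * r₃ + v₂ * s₃)
    ≡ (u₁ * r₁ + v₁ * s₁) * (u₃ * r₂ + v₃ * s₂) * (u₂ * r₃ + v₂ * s₃)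
    + (u₂ * r₁ + v₂ * s₁) * (u₁ * r₂ + v₁ * s₂) * (u₃ * r₃ + v₃ * s₃)
    + (u₃ * r₁ + v₃ * s₁) * (u₂ * r₂ + v₂ * s₂) * (u₁ * r₃ + v₁ * s₃)
  identity = solve-∀

ℤ₂₅-rawSemiring : RawSemiring 0ℓ 0ℓ
ℤ₂₅-rawSemiring = record
  { Carrier = ℤ₂₅ ; _≈_ = _≡_ ; _+_ = _⊕_ ; _*_ = _⊗_ ; 0# = 𝟘 ; 1# = 𝟙 }

open Determinant ℤ₂₅-rawSemiring using () renaming (Δ⁺ to Δ⁺₂₅; Δ⁻ to Δ⁻₂₅)
open DeterminantHomomorphism +-*-rawSemiring ℤ₂₅-rawSemiring reduce reduce-+ reduce-*

coords : V3 → Triple ℤ₂₅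
coords ⟨ a , b , c ⟩ = (a , b , c)

det⁺ det⁻ : V3 → V3 → V3 → ℤ₂₅
det⁺ p q w = Δ⁺₂₅ (coords p) (coords q) (coords w)
det⁻ p q w = Δ⁻₂₅ (coords p) (coords q) (coords w)

coords-combination : ∀ u v r s →
  coords ((u · r) +ᵛ (v · s)) ≡ map³ reduce (combine (map³ toℕ (coords u)) (map³ toℕ (coords v)) (toℕ r) (toℕ s))
coords-combination ⟨ u₁ , u₂ , u₃ ⟩ ⟨ v₁ , v₂ , v₃ ⟩ r s =
  sym (cong₂ _,_ (coordinate u₁ v₁) (cong₂ _,_ (coordinate u₂ v₂) (coordinate u₃ v₃)))
  where
  coordinate : ∀ a b → reduce (toℕ a * toℕ r + toℕ b * toℕ s) ≡ a ⊗ r ⊕ b ⊗ s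
  coordinate a b = reduce-+ (toℕ a * toℕ r) (toℕ b * toℕ s)

collinear⇒det⁺≡det⁻ : ∀ {p q w} → Collinear p q w → det⁺ p q w ≡ det⁻ p q w
collinear⇒det⁺≡det⁻ (u , v , _ , (r₁ , s₁ , refl) , (r₂ , s₂ , refl) , (r₃ , s₃ , refl)) = begin
  det⁺ p₁ p₂ p₃                                        ≡⟨ cong₃ Δ⁺₂₅ e₁ e₂ e₃ ⟩
  Δ⁺₂₅ (map³ reduce x) (map³ reduce y) (map³ reduce z) ≡⟨ sym (Δ⁺-hom x y z) ⟩
  reduce (Δ⁺ℕ x y z)                                   ≡⟨ cong reduce (Δ-span-vanishes U V (toℕ r₁) (toℕ s₁) (toℕ r₂) (toℕ s₂) (toℕ r₃) (toℕ s₃)) ⟩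
  reduce (Δ⁻ℕ x y z)                                   ≡⟨ Δ⁻-hom x y z ⟩
  Δ⁻₂₅ (map³ reduce x) (map³ reduce y) (map³ reduce z) ≡⟨ sym (cong₃ Δ⁻₂₅ e₁ e₂ e₃) ⟩
  det⁻ p₁ p₂ p₃                                        ∎
  where
  open ≡-Reasoning
  p₁ p₂ p₃ : V3
  p₁ = (u · r₁) +ᵛ (v · s₁)
  p₂ = (u · r₂) +ᵛ (v · s₂)
  p₃ = (u · r₃) +ᵛ (v · s₃)
  U V x y z : Triple ℕ
  U = map³ toℕ (coords u)
  V = map³ toℕ (coords v)
  x = combine U V (toℕ r₁) (toℕ s₁)
  y = combine U V (toℕ r₂) (toℕ s₂)
  z = combine U V (toℕ r₃) (toℕ s₃)
  e₁ : coords p₁ ≡ map³ reduce x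
  e₁ = coords-combination u v r₁ s₁
  e₂ : coords p₂ ≡ map³ reduce y
  e₂ = coords-combination u v r₂ s₂
  e₃ : coords p₃ ≡ map³ reduce z
  e₃ = coords-combination u v r₃ s₃

infix 4 _≟ᵛ_
_≟ᵛ_ : DecidableEquality V3
⟨ a , b , c ⟩ ≟ᵛ ⟨ a′ , b′ , c′ ⟩ =
  map′ (λ { (a≡a′ , b≡b′ , c≡c′) → cong₃ ⟨_,_,_⟩ a≡a′ b≡b′ c≡c′ })
       (λ p≡p′ → cong c₁ p≡p′ , cong c₂ p≡p′ , cong c₃ p≡p′)
       (a ≟ a′ ×-dec b ≟ b′ ×-dec c ≟ c′)

isUnit? : Decidable IsUnit
isUnit? a = any? λ b → a ⊗ b ≟ 𝟙

isPoint? : Decidable IsPoint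
isPoint? ⟨ a , b , c ⟩ = isUnit? a ⊎-dec isUnit? b ⊎-dec isUnit? c

not-multiple⇒¬SamePoint : ∀ {p q} → (∀ r → p ≢ q · r) → ¬ SamePoint p q
not-multiple⇒¬SamePoint not-multiple ((r , p≡qr) , _) = not-multiple r p≡qr

det⁺≢det⁻⇒¬Collinear : ∀ {p q w} → det⁺ p q w ≢ det⁻ p q w → ¬ Collinear p q w
det⁺≢det⁻⇒¬Collinear det≢ = det≢ ∘ collinear⇒det⁺≡det⁻

kZ25-points : ∀ i → IsPoint (kZ25 i)
kZ25-points = from-yes (all? λ i → isPoint? (kZ25 i))

kZ25-not-multiples : ∀ i j → i ≢ j → ∀ r → kZ25 i ≢ kZ25 j · r
kZ25-not-multiples = from-yes (all? λ i → all? λ j →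
  ¬? (i ≟ j) →-dec all? λ r → ¬? (kZ25 i ≟ᵛ kZ25 j · r))

kZ25-det≢ : ∀ i j l → i ≢ j → i ≢ l → j ≢ l →
  det⁺ (kZ25 i) (kZ25 j) (kZ25 l) ≢ det⁻ (kZ25 i) (kZ25 j) (kZ25 l)
kZ25-det≢ = from-yes (all? λ i → all? λ j → all? λ l →
  ¬? (i ≟ j) →-dec ¬? (i ≟ l) →-dec ¬? (j ≟ l) →-dec
  ¬? (det⁺ (kZ25 i) (kZ25 j) (kZ25 l) ≟ det⁻ (kZ25 i) (kZ25 j) (kZ25 l)))

mainTheorem1 : Is2Arc kZ25
mainTheorem1 =
    kZ25-points
  , (λ i j i≢j → not-multiple⇒¬SamePoint (kZ25-not-multiples i j i≢j))
  , (λ i j l i≢j i≢l j≢l → det⁺≢det⁻⇒¬Collinear (kZ25-det≢ i j l i≢j i≢l j≢l))
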